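{- Let $G$ be a graph of order $n\ge 3$ with minimum degree $\delta(G)=1$ and with exactly one full vertex. Then $\mathcal{C}(G)=n$ if and only if $G$ is obtained from the graph $K_1\cup K_{n-1}$ by adding an edge joining the isolated vertex to an arbitrary vertex of the complete graph $K_{n-1}$.
   Context: All graphs are finite and simple. For a graph $G$ with vertex set $V$, a set $S\subseteq V$ is a dominating set if every vertex of $V\setminus S$ is adjacent to a vertex of $S$. Two disjoint sets $V_1,V_2\subseteq V$ form a coalition in $G$ if neither is a dominating set of $G$ but $V_1\cup V_2$ is. A coalition partition of $G$ is a partition $\Psi=\{V_1,\ldots,V_k\}$ of $V$ such that every $V_i\in\Psi$ is either a dominating set of $G$ with $|V_i|=1$, or is not a dominating set and forms a coalition with some $V_j\in\Psi$. The coalition number $\mathcal{C}(G)$ is the maximum cardinality of a coalition partition of $G$. The order is $n=|V|$; a full vertex is a vertex of degree $n-1$. -}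

module Defs where

open import Data.Nat using (ℕ; zero; suc; _+_; _∸_; _≤_)
open import Data.Nat.Base using (_≡ᵇ_)
open import Data.Bool using (Bool; true; false; if_then_else_; _∧_; not)
open import Data.Fin using (Fin; toℕ)
open import Data.Fin.Properties using (_≟_)
open import Data.List using (List; map; allFin)
open import Data.Nat.ListAction using (sum)
open import Data.Product using (Σ; ∃; ∃-syntax; _×_; _,_)
open import Data.Sum using (_⊎_)
open import Relation.Nullary using (¬_; does)
open import Relation.Binary.PropositionalEquality using (_≡_; _≢_)
open import Function.Bundles using (_↔_; Inverse)

record Graph (n : ℕ) : Set where
  field
    adj    : Fin n → Fin n → Bool
    sym    : ∀ u v → adj u v ≡ adj v u
    irrefl : ∀ v → adj v v ≡ false
open Graph public

degree : ∀ {n} → Graph n → Fin n → ℕ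
degree G v = sum (map (λ u → if adj G v u then 1 else 0) (allFin _))

MinDegree : ∀ {n} → Graph n → ℕ → Set
MinDegree G d = (∀ v → d ≤ degree G v) × (∃[ v ] degree G v ≡ d)

Full : ∀ {n} → Graph n → Fin n → Set
Full {n} G v = degree G v ≡ n ∸ 1

ExactlyOneFull : ∀ {n} → Graph n → Set
ExactlyOneFull G = ∃[ v ] (Full G v × (∀ w → Full G w → w ≡ v))

Dominating : ∀ {n} → Graph n → (Fin n → Set) → Set
Dominating G S = ∀ v → S v ⊎ (∃[ u ] (S u × adj G u v ≡ true))

-- A partition of V into k (nonempty) classes, given by a surjective labelling
-- p : V → Fin k; the classes are V_i = { v | p v ≡ i }.
Block : ∀ {n k} → (Fin n → Fin k) → Fin k → Fin n → Set
Block p i v = p v ≡ i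

Union : ∀ {n} → (Fin n → Set) → (Fin n → Set) → Fin n → Set
Union A B v = A v ⊎ B v

Singleton : ∀ {n} → (Fin n → Set) → Set
Singleton S = ∃[ v ] S v × (∀ w → S w → w ≡ v)

IsCoalitionPartition : ∀ {n k} → Graph n → (Fin n → Fin k) → Set
IsCoalitionPartition {n} {k} G p =
  (∀ i → ∃[ v ] p v ≡ i) ×
  (∀ i → (Dominating G (Block p i) × Singleton (Block p i))
       ⊎ (¬ Dominating G (Block p i) ×
           ∃[ j ] (i ≢ j × ¬ Dominating G (Block p j)
                   × Dominating G (Union (Block p i) (Block p j)))))

HasCoalitionPartition : ∀ {n} → Graph n → ℕ → Set
HasCoalitionPartition {n} G k = Σ (Fin n → Fin k) (IsCoalitionPartition G)

CoalitionNumber : ∀ {n} → Graph n → ℕ → Set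
CoalitionNumber G k =
  HasCoalitionPartition G k × (∀ m → HasCoalitionPartition G m → m ≤ k)

-- The graph K₁ ∪ K_{n-1} with an added edge joining the isolated vertex 0
-- to vertex 1 of the complete graph on {1,…,n-1}.
pendAdj : ∀ {n} → Fin n → Fin n → Bool
pendAdj i j =
  not (does (i ≟ j)) ∧
  (if toℕ i ≡ᵇ 0 then toℕ j ≡ᵇ 1
   else if toℕ j ≡ᵇ 0 then toℕ i ≡ᵇ 1
   else true)

Isomorphic : ∀ {n} → Graph n → (Fin n → Fin n → Bool) → Set
Isomorphic {n} G H = Σ (Fin n ↔ Fin n) λ f →
  ∀ u v → adj G u v ≡ H (Inverse.to f u) (Inverse.to f v)

-- A coalition partition with n classes consists of singletons. If u is neither the
-- leaf x nor the full vertex c, then {u} is not dominating (u would be a second full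
-- vertex), so it has a partner {w}; as x is adjacent only to c and {c} dominates, the
-- partner must be {x}, and then {u, x} dominating makes u adjacent to every vertex
-- other than x. So G is K_{n-1} with a pendant edge at c. Conversely, in that graph
-- {c} dominates, {x} pairs with any third vertex, and every other {u} pairs with {x}.
module Submission where

open import Defs hiding (sym)
open import Data.Bool using (Bool; true; false; if_then_else_; not; _∧_)
open import Data.Bool.Properties using (¬-not)
open import Data.Fin using (Fin; zero; suc; punchIn; punchOut)
open import Data.Fin.Patterns using (0F; 1F; 2F)
open import Data.Fin.Properties using (_≟_; 0≢1+n; suc-injective; injective⇒≤; punchIn-punchOut)
open import Data.Fin.Permutation using (Permutation′; flip; transpose; _∘ₚ_; _⟨$⟩ʳ_; _⟨$⟩ˡ_; inverseˡ)
open import Data.List using (tabulate)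
open import Data.List.Properties using (map-tabulate)
open import Data.Nat using (ℕ; zero; suc; 2+; _+_; _≤_; z≤n; s≤s)
open import Data.Nat.ListAction using (sum)
open import Data.Nat.Properties using (≤-trans; ≤-antisym; m≤n+m; +-suc; +-comm; +-cancelˡ-≡; +-cancelʳ-≡; 1+n≰n)
open import Data.Product using (∃-syntax; _×_; _,_; proj₁; proj₂)
open import Data.Sum using (_⊎_; inj₁; inj₂)
open import Function using (_∘_; _⇔_; mk⇔; Equivalence)
open import Function.Definitions using (Injective)
open import Function.Bundles using (Injection)
open import Function.Properties.Inverse using (↔⇒↣)
open import Relation.Nullary using (¬_; yes; no; does)
open import Relation.Nullary.Decidable using (dec-true; dec-false; does-⇔)
open import Relation.Nullary.Negation using (contradiction)
open import Relation.Binary.PropositionalEquality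

count : ∀ {n} → (Fin n → Bool) → ℕ
count b = sum (tabulate (λ u → if b u then 1 else 0))

degree≡count : ∀ {n} (G : Graph n) v → degree G v ≡ count (adj G v)
degree≡count G v = cong sum (map-tabulate (λ u → u) (λ u → if adj G v u then 1 else 0))

count-none : ∀ {n} (b : Fin n → Bool) → (∀ u → b u ≡ false) → count b ≡ 0
count-none {zero} b none = refl
count-none {suc n} b none rewrite none zero = count-none (b ∘ suc) (none ∘ suc)

count-≤1 : ∀ {n} (b : Fin n → Bool) {a} → (∀ u → b u ≡ true → u ≡ a) → count b ≤ 1
count-≤1 {suc n} b {zero} only-a
  rewrite count-none (b ∘ suc) (λ u → ¬-not (0≢1+n ∘ sym ∘ only-a (suc u))) with b zero
... | true = s≤s z≤n
... | false = z≤n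
count-≤1 {suc n} b {suc a} only-a rewrite ¬-not (0≢1+n ∘ only-a zero) =
  count-≤1 (b ∘ suc) (λ u e → suc-injective (only-a (suc u) e))

count-+-count-not : ∀ {n} (b : Fin n → Bool) → count b + count (not ∘ b) ≡ n
count-+-count-not {zero} b = refl
count-+-count-not {suc n} b with b zero
... | true = cong suc (count-+-count-not (b ∘ suc))
... | false = trans (+-suc _ _) (cong suc (count-+-count-not (b ∘ suc)))

count-≥1 : ∀ {n} (b : Fin n → Bool) {a} → b a ≡ true → 1 ≤ count b
count-≥1 b {zero} e rewrite e = s≤s z≤n
count-≥1 b {suc a} e = ≤-trans (count-≥1 (b ∘ suc) e) (m≤n+m _ _)

count-≥2 : ∀ {n} (b : Fin n → Bool) {a a′} → a ≢ a′ →
  b a ≡ true → b a′ ≡ true → 2 ≤ count b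
count-≥2 b {zero} {zero} a≢a′ _ _ = contradiction refl a≢a′
count-≥2 b {zero} {suc a′} _ e e′ rewrite e = s≤s (count-≥1 (b ∘ suc) e′)
count-≥2 b {suc a} {zero} _ e e′ rewrite e′ = s≤s (count-≥1 (b ∘ suc) e)
count-≥2 b {suc a} {suc a′} a≢a′ e e′ =
  ≤-trans (count-≥2 (b ∘ suc) (a≢a′ ∘ cong suc) e e′) (m≤n+m _ _)

Full⇔one-non-neighbour : ∀ {m} (G : Graph (suc m)) v → Full G v ⇔ count (not ∘ adj G v) ≡ 1
Full⇔one-non-neighbour {m} G v = mk⇔
  (λ d≡m → +-cancelˡ-≡ m k 1
    (trans (subst (λ d → d + k ≡ suc m) d≡m split) (+-comm 1 m)))
  (λ k≡1 → +-cancelʳ-≡ 1 (degree G v) m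
    (trans (subst (λ k → degree G v + k ≡ suc m) k≡1 split) (+-comm 1 m)))
  where
  k : ℕ
  k = count (not ∘ adj G v)
  split : degree G v + k ≡ suc m
  split = trans (cong (_+ k) (degree≡count G v)) (count-+-count-not (adj G v))

Full⇒adjacent : ∀ {m} (G : Graph (suc m)) {v u} → Full G v → u ≢ v → adj G v u ≡ true
Full⇒adjacent G {v} {u} full u≢v with adj G v u in e
... | true = refl
... | false = contradiction
  (subst (2 ≤_) (Equivalence.to (Full⇔one-non-neighbour G v) full)
    (count-≥2 (not ∘ adj G v) u≢v (cong not e) (cong not (irrefl G v))))
  1+n≰n

adjacent⇒Full : ∀ {m} (G : Graph (suc m)) {v} → (∀ u → u ≢ v → adj G v u ≡ true) → Full G v
adjacent⇒Full G {v} adj-all = Equivalence.from (Full⇔one-non-neighbour G v)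
  (≤-antisym (count-≤1 (not ∘ adj G v) only-v) (count-≥1 (not ∘ adj G v) (cong not (irrefl G v))))
  where
  only-v : ∀ u → not (adj G v u) ≡ true → u ≡ v
  only-v u e with u ≟ v
  ... | yes u≡v = u≡v
  ... | no u≢v = contradiction (trans (sym (cong not (adj-all u u≢v))) e) λ ()

degree-1⇒unique-neighbour : ∀ {n} (G : Graph n) {v a a′} → degree G v ≡ 1 →
  adj G v a ≡ true → adj G v a′ ≡ true → a ≡ a′
degree-1⇒unique-neighbour G {v} {a} {a′} d≡1 e e′ with a ≟ a′
... | yes a≡a′ = a≡a′
... | no a≢a′ = contradiction
  (subst (2 ≤_) (trans (sym (degree≡count G v)) d≡1) (count-≥2 (adj G v) a≢a′ e e′)) 1+n≰n

degree-1≢Full : ∀ {k} (G : Graph (3 + k)) {x c} → degree G x ≡ 1 → Full G c → x ≢ c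
degree-1≢Full G leaf full refl = contradiction (trans (sym leaf) full) λ ()

surjective⇒≤ : ∀ {m n} {p : Fin m → Fin n} → (∀ i → ∃[ v ] p v ≡ i) → n ≤ m
surjective⇒≤ {p = p} surj = injective⇒≤ {f = proj₁ ∘ surj}
  (λ {i} {j} e → trans (sym (proj₂ (surj i))) (trans (cong p e) (proj₂ (surj j))))

surjective⇒injective : ∀ {n} {p : Fin n → Fin n} → (∀ i → ∃[ v ] p v ≡ i) →
  Injective _≡_ _≡_ p
surjective⇒injective {suc m} {p} surj {a} {b} pa≡pb with a ≟ b
... | yes a≡b = a≡b
... | no a≢b = contradiction (surjective⇒≤ {p = p ∘ punchIn b} avoiding-b) 1+n≰n
  where
  preimage≢b : ∀ i → ∃[ v ] b ≢ v × p v ≡ i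
  preimage≢b i with surj i
  ... | v , pv≡i with b ≟ v
  ...   | yes refl = a , a≢b ∘ sym , trans pa≡pb pv≡i
  ...   | no b≢v = v , b≢v , pv≡i
  avoiding-b : ∀ i → ∃[ v ] p (punchIn b v) ≡ i
  avoiding-b i with preimage≢b i
  ... | v , b≢v , pv≡i = punchOut b≢v , trans (cong p (punchIn-punchOut b≢v)) pv≡i

transpose-matchˡ : ∀ {n} (i j : Fin n) → transpose i j ⟨$⟩ʳ i ≡ j
transpose-matchˡ i j rewrite dec-true (i ≟ i) refl = refl

transpose-other : ∀ {n} (i j : Fin n) {k} → k ≢ i → k ≢ j → transpose i j ⟨$⟩ʳ k ≡ k
transpose-other i j {k} k≢i k≢j rewrite dec-false (k ≟ i) k≢i | dec-false (k ≟ j) k≢j = refl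

permutation-injective : ∀ {n} (π : Permutation′ n) → Injective _≡_ _≡_ (π ⟨$⟩ʳ_)
permutation-injective π = Injection.injective (↔⇒↣ π)

permutation-sending : ∀ {n} {x c x′ c′ : Fin n} → x ≢ c → x′ ≢ c′ →
  ∃[ π ] (π ⟨$⟩ʳ x ≡ x′ × π ⟨$⟩ʳ c ≡ c′)
permutation-sending {x = x} {c} {x′} {c′} x≢c x′≢c′ =
  transpose x x′ ∘ₚ transpose c″ c′ ,
  trans (cong (transpose c″ c′ ⟨$⟩ʳ_) (transpose-matchˡ x x′))
        (transpose-other c″ c′ x′≢c″ x′≢c′) ,
  transpose-matchˡ c″ c′
  where
  c″ : Fin _
  c″ = transpose x x′ ⟨$⟩ʳ c
  x′≢c″ : x′ ≢ c″
  x′≢c″ e = x≢c (permutation-injective (transpose x x′) (trans (transpose-matchˡ x x′) e))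

pendantAdj : ∀ {n} → Fin n → Fin n → Fin n → Fin n → Bool
pendantAdj x c u v =
  not (does (u ≟ v)) ∧
  (if does (u ≟ x) then does (v ≟ c)
   else if does (v ≟ x) then does (u ≟ c)
   else true)

pendantAdj-pendant : ∀ {n} {x c : Fin n} → x ≢ c → ∀ v → pendantAdj x c x v ≡ does (v ≟ c)
pendantAdj-pendant {x = x} {c} x≢c v with x ≟ v
... | yes refl = sym (dec-false (x ≟ c) x≢c)
... | no _ rewrite dec-true (x ≟ x) refl = refl

pendantAdj-clique : ∀ {n} {x c u v : Fin n} → u ≢ x → v ≢ x → u ≢ v → pendantAdj x c u v ≡ true
pendantAdj-clique {x = x} {u = u} {v} u≢x v≢x u≢v
  rewrite dec-false (u ≟ v) u≢v | dec-false (u ≟ x) u≢x | dec-false (v ≟ x) v≢x = refl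

pendAdj≡pendantAdj : ∀ {k} (u v : Fin (2+ k)) → pendAdj u v ≡ pendantAdj 0F 1F u v
pendAdj≡pendantAdj 0F 0F = refl
pendAdj≡pendantAdj 0F 1F = refl
pendAdj≡pendantAdj 0F (suc (suc v)) = refl
pendAdj≡pendantAdj 1F 0F = refl
pendAdj≡pendantAdj 1F 1F = refl
pendAdj≡pendantAdj 1F (suc (suc v)) = refl
pendAdj≡pendantAdj (suc (suc u)) 0F = refl
pendAdj≡pendantAdj (suc (suc u)) 1F = refl
pendAdj≡pendantAdj (suc (suc u)) (suc (suc v)) = refl

does-≟-injective : ∀ {m n} {f : Fin m → Fin n} → Injective _≡_ _≡_ f →
  ∀ a b → does (f a ≟ f b) ≡ does (a ≟ b)
does-≟-injective {f = f} f-inj a b = does-⇔ (mk⇔ f-inj (cong f)) (f a ≟ f b) (a ≟ b)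

pendantAdj-relabel : ∀ {m n} {f : Fin m → Fin n} → Injective _≡_ _≡_ f →
  ∀ x c u v → pendantAdj (f x) (f c) (f u) (f v) ≡ pendantAdj x c u v
pendantAdj-relabel f-inj x c u v
  rewrite does-≟-injective f-inj u v | does-≟-injective f-inj u x | does-≟-injective f-inj v c
        | does-≟-injective f-inj v x | does-≟-injective f-inj u c = refl

record PendantComplete {n} (G : Graph n) (x c : Fin n) : Set where
  field
    pendant : ∀ v → adj G x v ≡ does (v ≟ c)
    clique  : ∀ {u v} → u ≢ x → v ≢ x → u ≢ v → adj G u v ≡ true

  x≢c : x ≢ c
  x≢c x≡c = contradiction (trans (sym (irrefl G x)) (trans (pendant x) (dec-true (x ≟ c) x≡c))) λ ()

  pendant-adjacent : adj G x c ≡ true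
  pendant-adjacent = trans (pendant c) (dec-true (c ≟ c) refl)

  pendant-non-adjacent : ∀ {v} → v ≢ c → adj G x v ≡ false
  pendant-non-adjacent {v} v≢c = trans (pendant v) (dec-false (v ≟ c) v≢c)

  non-adjacent-pendant : ∀ {v} → v ≢ c → adj G v x ≡ false
  non-adjacent-pendant {v} v≢c = trans (Graph.sym G v x) (pendant-non-adjacent v≢c)

  hub-adjacent : ∀ {v} → v ≢ c → adj G c v ≡ true
  hub-adjacent {v} v≢c with v ≟ x
  ... | yes refl = trans (Graph.sym G c x) pendant-adjacent
  ... | no v≢x = clique (x≢c ∘ sym) v≢x (v≢c ∘ sym)

module _ {n} {G : Graph n} {x c : Fin n} where

  PendantComplete⇒pendantAdj : PendantComplete G x c → ∀ u v → adj G u v ≡ pendantAdj x c u v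
  PendantComplete⇒pendantAdj pc u v with u ≟ v | u ≟ x | v ≟ x
  ... | yes refl | _ | _ = irrefl G u
  ... | no u≢v | yes refl | _ = PendantComplete.pendant pc v
  ... | no u≢v | no u≢x | yes refl = trans (Graph.sym G u x) (PendantComplete.pendant pc u)
  ... | no u≢v | no u≢x | no v≢x = PendantComplete.clique pc u≢x v≢x u≢v

  pendantAdj⇒PendantComplete : x ≢ c → (∀ u v → adj G u v ≡ pendantAdj x c u v) →
    PendantComplete G x c
  pendantAdj⇒PendantComplete x≢c adj≡ = record
    { pendant = λ v → trans (adj≡ x v) (pendantAdj-pendant x≢c v)
    ; clique  = λ {u} {v} u≢x v≢x u≢v → trans (adj≡ u v) (pendantAdj-clique u≢x v≢x u≢v)
    }

PendantComplete⇒Isomorphic : ∀ {k} {G : Graph (2+ k)} {x c} → PendantComplete G x c → Isomorphic G pendAdj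
PendantComplete⇒Isomorphic {G = G} {x} {c} pc
  with π , πx≡0 , πc≡1 ← permutation-sending {x′ = 0F} {c′ = 1F} (PendantComplete.x≢c pc) (λ ())
  = π , λ u v → begin
    adj G u v
      ≡⟨ PendantComplete⇒pendantAdj pc u v ⟩
    pendantAdj x c u v
      ≡⟨ pendantAdj-relabel (permutation-injective π) x c u v ⟨
    pendantAdj (π ⟨$⟩ʳ x) (π ⟨$⟩ʳ c) (π ⟨$⟩ʳ u) (π ⟨$⟩ʳ v)
      ≡⟨ cong₂ (λ a b → pendantAdj a b (π ⟨$⟩ʳ u) (π ⟨$⟩ʳ v)) πx≡0 πc≡1 ⟩
    pendantAdj 0F 1F (π ⟨$⟩ʳ u) (π ⟨$⟩ʳ v)
      ≡⟨ pendAdj≡pendantAdj (π ⟨$⟩ʳ u) (π ⟨$⟩ʳ v) ⟨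
    pendAdj (π ⟨$⟩ʳ u) (π ⟨$⟩ʳ v)
      ∎
  where open ≡-Reasoning

Isomorphic⇒PendantComplete : ∀ {k} {G : Graph (2+ k)} ((π , _) : Isomorphic G pendAdj) →
  PendantComplete G (π ⟨$⟩ˡ 0F) (π ⟨$⟩ˡ 1F)
Isomorphic⇒PendantComplete {G = G} (π , adj≡) =
  pendantAdj⇒PendantComplete (λ e → 0≢1 (from-injective e)) λ u v → begin
    adj G u v
      ≡⟨ adj≡ u v ⟩
    pendAdj (π ⟨$⟩ʳ u) (π ⟨$⟩ʳ v)
      ≡⟨ pendAdj≡pendantAdj (π ⟨$⟩ʳ u) (π ⟨$⟩ʳ v) ⟩
    pendantAdj 0F 1F (π ⟨$⟩ʳ u) (π ⟨$⟩ʳ v)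
      ≡⟨ pendantAdj-relabel from-injective 0F 1F (π ⟨$⟩ʳ u) (π ⟨$⟩ʳ v) ⟨
    pendantAdj x c (π ⟨$⟩ˡ (π ⟨$⟩ʳ u)) (π ⟨$⟩ˡ (π ⟨$⟩ʳ v))
      ≡⟨ cong₂ (pendantAdj x c) (inverseˡ π) (inverseˡ π) ⟩
    pendantAdj x c u v
      ∎
  where
  open ≡-Reasoning
  x c : Fin _
  x = π ⟨$⟩ˡ 0F
  c = π ⟨$⟩ˡ 1F
  from-injective : Injective _≡_ _≡_ (π ⟨$⟩ˡ_)
  from-injective = permutation-injective (flip π)
  0≢1 : 0F ≢ 1F
  0≢1 ()

CoalitionClass : ∀ {n k} → Graph n → (Fin n → Fin k) → Fin k → Set
CoalitionClass G p i =
  (Dominating G (Block p i) × Singleton (Block p i))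
  ⊎ (¬ Dominating G (Block p i) ×
     ∃[ j ] (i ≢ j × ¬ Dominating G (Block p j) × Dominating G (Union (Block p i) (Block p j))))

Full⇒dominating : ∀ {m} (G : Graph (suc m)) {c} {S : Fin (suc m) → Set} →
  Full G c → S c → Dominating G S
Full⇒dominating G {c} full c∈S v with v ≟ c
... | yes refl = inj₁ c∈S
... | no v≢c = inj₂ (c , c∈S , Full⇒adjacent G full v≢c)

module _ {n} (G : Graph n) where

  singleton-dominating : ∀ {u} → (∀ {v} → v ≢ u → adj G u v ≡ true) →
    Dominating G (Block {k = n} (λ v → v) u)
  singleton-dominating {u} adjacent v with v ≟ u
  ... | yes v≡u = inj₁ v≡u
  ... | no v≢u = inj₂ (u , refl , adjacent v≢u)

  singleton-not-dominating : ∀ {u v} → v ≢ u → adj G u v ≡ false →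
    ¬ Dominating G (Block {k = n} (λ v → v) u)
  singleton-not-dominating v≢u non-adjacent dom with dom _
  ... | inj₁ v≡u = v≢u v≡u
  ... | inj₂ (_ , refl , adjacent) = contradiction (trans (sym non-adjacent) adjacent) λ ()

  pair-dominating : ∀ {a b} → (∀ {v} → v ≢ a → v ≢ b → adj G a v ≡ true ⊎ adj G b v ≡ true) →
    Dominating G (Union (Block {k = n} (λ v → v) a) (Block (λ v → v) b))
  pair-dominating {a} {b} covered v with v ≟ a | v ≟ b
  ... | yes v≡a | _ = inj₁ (inj₁ v≡a)
  ... | no _ | yes v≡b = inj₁ (inj₂ v≡b)
  ... | no v≢a | no v≢b with covered v≢a v≢b
  ...   | inj₁ adjacent = inj₂ (a , inj₁ refl , adjacent)
  ...   | inj₂ adjacent = inj₂ (b , inj₂ refl , adjacent)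

PendantComplete⇒singleton-partition : ∀ {n} {G : Graph n} {x c t : Fin n} → PendantComplete G x c →
  t ≢ x → t ≢ c → IsCoalitionPartition G (λ v → v)
PendantComplete⇒singleton-partition {G = G} {x} {c} {t} pc t≢x t≢c = (λ i → i , refl) , classify
  where
  open PendantComplete pc
  classify : ∀ i → CoalitionClass G (λ v → v) i
  classify i with i ≟ c
  ... | yes refl = inj₁ (singleton-dominating G hub-adjacent , i , refl , λ _ w≡i → w≡i)
  ... | no i≢c with i ≟ x
  ...   | yes refl = inj₂
    ( singleton-not-dominating G t≢x (pendant-non-adjacent t≢c)
    , t , (t≢x ∘ sym)
    , singleton-not-dominating G (t≢x ∘ sym) (non-adjacent-pendant t≢c)
    , pair-dominating G covered )
    where
    covered : ∀ {v} → v ≢ x → v ≢ t → adj G x v ≡ true ⊎ adj G t v ≡ true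
    covered {v} v≢x v≢t with v ≟ c
    ... | yes refl = inj₁ pendant-adjacent
    ... | no _ = inj₂ (clique t≢x v≢x (v≢t ∘ sym))
  ...   | no i≢x = inj₂
    ( singleton-not-dominating G (i≢x ∘ sym) (non-adjacent-pendant i≢c)
    , x , i≢x
    , singleton-not-dominating G i≢x (pendant-non-adjacent i≢c)
    , pair-dominating G covered )
    where
    covered : ∀ {v} → v ≢ i → v ≢ x → adj G i v ≡ true ⊎ adj G x v ≡ true
    covered {v} v≢i v≢x with v ≟ c
    ... | yes refl = inj₂ pendant-adjacent
    ... | no _ = inj₁ (clique i≢x v≢x (v≢i ∘ sym))

PendantComplete⇒CoalitionNumber : ∀ {n} {G : Graph n} {x c t} → PendantComplete G x c →
  t ≢ x → t ≢ c → CoalitionNumber G n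
PendantComplete⇒CoalitionNumber pc t≢x t≢c =
  ((λ v → v) , PendantComplete⇒singleton-partition pc t≢x t≢c) ,
  λ _ (_ , partition) → surjective⇒≤ (proj₁ partition)

Isomorphic⇒CoalitionNumber : ∀ {k} (G : Graph (3 + k)) → Isomorphic G pendAdj → CoalitionNumber G (3 + k)
Isomorphic⇒CoalitionNumber G iso@(π , _) =
  PendantComplete⇒CoalitionNumber {t = π ⟨$⟩ˡ 2F} (Isomorphic⇒PendantComplete {G = G} iso)
    (2≢0 ∘ from-injective) (2≢1 ∘ from-injective)
  where
  from-injective : Injective _≡_ _≡_ (π ⟨$⟩ˡ_)
  from-injective = permutation-injective (flip π)
  2≢0 : 2F ≢ 0F
  2≢0 ()
  2≢1 : 2F ≢ 1F
  2≢1 ()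

module _ {m} {G : Graph (suc m)} {p : Fin (suc m) → Fin (suc m)} (partition : IsCoalitionPartition G p) where

  private
    p-injective : Injective _≡_ _≡_ p
    p-injective = surjective⇒injective (proj₁ partition)

  dominating-class⇒Full : ∀ {u} → Dominating G (Block p (p u)) → Full G u
  dominating-class⇒Full {u} dom = adjacent⇒Full G adjacent
    where
    adjacent : ∀ z → z ≢ u → adj G u z ≡ true
    adjacent z z≢u with dom z
    ... | inj₁ pz≡pu = contradiction (p-injective pz≡pu) z≢u
    ... | inj₂ (w , pw≡pu , w-z) = subst (λ w → adj G w z ≡ true) (p-injective pw≡pu) w-z

  module _ {x c} (x≢c : x ≢ c) (leaf : degree G x ≡ 1) (full : Full G c) where

    private
      hub : ∀ {v} → v ≢ c → adj G c v ≡ true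
      hub = Full⇒adjacent G full

      x-c : adj G x c ≡ true
      x-c = trans (Graph.sym G x c) (hub x≢c)

      only-neighbour : ∀ {v} → adj G x v ≡ true → v ≡ c
      only-neighbour x-v = degree-1⇒unique-neighbour G leaf x-v x-c

      only-neighbourˡ : ∀ {v} → adj G v x ≡ true → v ≡ c
      only-neighbourˡ {v} v-x = only-neighbour (trans (Graph.sym G x v) v-x)

    partner-contains-leaf : ∀ {u j} → u ≢ x → u ≢ c → ¬ Dominating G (Block p j) →
      Dominating G (Union (Block p (p u)) (Block p j)) → p x ≡ j
    partner-contains-leaf {j = j} u≢x u≢c ¬dom-j dom-union with dom-union x
    ... | inj₁ (inj₁ px≡pu) = contradiction (p-injective px≡pu) (u≢x ∘ sym)
    ... | inj₁ (inj₂ px≡j) = px≡j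
    ... | inj₂ (z , inj₁ pz≡pu , z-x) =
      contradiction (trans (sym (p-injective pz≡pu)) (only-neighbourˡ z-x)) u≢c
    ... | inj₂ (z , inj₂ pz≡j , z-x) =
      contradiction (Full⇒dominating G full (subst (λ z → p z ≡ j) (only-neighbourˡ z-x) pz≡j)) ¬dom-j

    adjacent-off-hub : (∀ w → Full G w → w ≡ c) →
      ∀ {u v} → u ≢ x → v ≢ x → u ≢ v → u ≢ c → v ≢ c → adj G u v ≡ true
    adjacent-off-hub unique-full {u} {v} u≢x v≢x u≢v u≢c v≢c with proj₂ partition (p u)
    ... | inj₁ (dom , _) = contradiction (unique-full u (dominating-class⇒Full dom)) u≢c
    ... | inj₂ (_ , j , _ , ¬dom-j , dom-union)
      with partner-contains-leaf u≢x u≢c ¬dom-j dom-union | dom-union v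
    ...   | _ | inj₁ (inj₁ pv≡pu) = contradiction (p-injective pv≡pu) (u≢v ∘ sym)
    ...   | px≡j | inj₁ (inj₂ pv≡j) = contradiction (p-injective (trans pv≡j (sym px≡j))) v≢x
    ...   | _ | inj₂ (z , inj₁ pz≡pu , z-v) = subst (λ z → adj G z v ≡ true) (p-injective pz≡pu) z-v
    ...   | px≡j | inj₂ (z , inj₂ pz≡j , z-v) = contradiction
      (only-neighbour (subst (λ z → adj G z v ≡ true) (p-injective (trans pz≡j (sym px≡j))) z-v))
      v≢c

    maximum-partition⇒PendantComplete : (∀ w → Full G w → w ≡ c) → PendantComplete G x c
    maximum-partition⇒PendantComplete unique-full = record { pendant = pendant ; clique = clique }
      where
      pendant : ∀ v → adj G x v ≡ does (v ≟ c)
      pendant v with v ≟ c | adj G x v in x-v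
      ... | yes refl | _ = trans (sym x-v) x-c
      ... | no v≢c | true = contradiction (only-neighbour x-v) v≢c
      ... | no _ | false = refl
      clique : ∀ {u v} → u ≢ x → v ≢ x → u ≢ v → adj G u v ≡ true
      clique {u} {v} u≢x v≢x u≢v with u ≟ c | v ≟ c
      ... | yes refl | _ = hub (u≢v ∘ sym)
      ... | no _ | yes refl = trans (Graph.sym G u v) (hub u≢v)
      ... | no u≢c | no v≢c = adjacent-off-hub unique-full u≢x v≢x u≢v u≢c v≢c

theorem6 : ∀ {n} (G : Graph n) → 3 ≤ n → MinDegree G 1 → ExactlyOneFull G →
    (CoalitionNumber G n → Isomorphic G pendAdj) × (Isomorphic G pendAdj → CoalitionNumber G n)
theorem6 {suc (suc (suc k))} G (s≤s (s≤s (s≤s z≤n))) (_ , x , leaf) (c , full , unique-full) =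
  (λ ((_ , partition) , _) → PendantComplete⇒Isomorphic
    (maximum-partition⇒PendantComplete {G = G} partition
      (degree-1≢Full G leaf full) leaf full unique-full)) ,
  Isomorphic⇒CoalitionNumber G
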